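{- Let $A_1,\dots,A_k,B_1$ be weighted automata over $\Sigma$ whose product automaton has a strongly connected underlying graph, and let $r^a_1,\dots,r^a_k,r^b_1\in\mathbb{Q}$. There is a word $u\in\Sigma^\omega$ with $\mathrm{LimSupAvg}_{B_1}(u)\ge r^b_1$ and $\mathrm{LimInfAvg}_{A_i}(u)\ge r^a_i$ for all $i\in\{1,\dots,k\}$ if and only if there is a word $u'\in\Sigma^\omega$ with $\mathrm{LimInfAvg}_{B_1}(u')\ge r^b_1$ and $\mathrm{LimInfAvg}_{A_i}(u')\ge r^a_i$ for all $i\in\{1,\dots,k\}$.
   Context: A (deterministic) weighted automaton $A=\langle Q,q_I,\Sigma,\delta,w\rangle$ has exactly one successor per state and letter and weights $w:\delta\to\mathbb{Q}$; its run on $u$ starts at $q_I$ and has weight sequence $v_0v_1\dots$. $\mathrm{LimInfAvg}_A(u)=\liminf_n\frac1n\sum_{i<n}v_i$ and $\mathrm{LimSupAvg}_A(u)=\limsup_n\frac1n\sum_{i<n}v_i$. The product automaton has as states the tuples of states, with transitions on a letter given componentwise. -}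

module Defs where

open import Data.Nat using (ℕ; zero; suc)
open import Data.Fin using (Fin)
open import Data.List using (List; []; _∷_)
open import Data.Integer using (+_)
open import Data.Rational using (ℚ; 0ℚ; _+_; _-_; _*_; _/_; _≤_; _<_)
open import Data.Product using (Σ; ∃; _×_; _,_)
open import Relation.Binary.PropositionalEquality using (_≡_)

record WA (s : ℕ) : Set where
  field
    nQ : ℕ
    qI : Fin nQ
    δ  : Fin nQ → Fin s → Fin nQ
    w  : Fin nQ → Fin s → ℚ
open WA public

Word : ℕ → Set
Word s = ℕ → Fin s

run : ∀ {s} (A : WA s) → Word s → ℕ → Fin (nQ A)
run A u zero    = qI A
run A u (suc i) = δ A (run A u i) (u i)

weight : ∀ {s} (A : WA s) → Word s → ℕ → ℚ
weight A u i = w A (run A u i) (u i)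

psum : ∀ {s} (A : WA s) → Word s → ℕ → ℚ
psum A u zero    = 0ℚ
psum A u (suc n) = psum A u n + weight A u n

-- avg A u n = (1/(n+1)) Σ_{i<n+1} v_i   (the average of the first n+1 weights)
avg : ∀ {s} (A : WA s) → Word s → ℕ → ℚ
avg A u n = psum A u (suc n) * ((+ 1) / suc n)

-- LimInfAvg_A(u) ≥ r  (as an extended-real inequality), i.e.
-- for every ε > 0 eventually r - ε ≤ avg.
LimInfAvg≥ : ∀ {s} (A : WA s) → Word s → ℚ → Set
LimInfAvg≥ A u r = ∀ (ε : ℚ) → 0ℚ < ε →
  ∃ λ (N : ℕ) → ∀ (n : ℕ) → N Data.Nat.≤ n → (r - ε) ≤ avg A u n

LimSupAvg≥ : ∀ {s} (A : WA s) → Word s → ℚ → Set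
LimSupAvg≥ A u r = ∀ (ε : ℚ) → 0ℚ < ε → ∀ (N : ℕ) →
  ∃ λ (n : ℕ) → (N Data.Nat.≤ n) × ((r - ε) ≤ avg A u n)

δ* : ∀ {s} (A : WA s) → Fin (nQ A) → List (Fin s) → Fin (nQ A)
δ* A q []       = q
δ* A q (a ∷ xs) = δ* A (δ A q a) xs

PState : ∀ {s k} → (Fin k → WA s) → WA s → Set
PState {k = k} As B = ((i : Fin k) → Fin (nQ (As i))) × Fin (nQ B)

-- The finite word x leads from p to q in the product automaton
-- (transitions act componentwise; tuple equality stated componentwise).
PStep : ∀ {s k} (As : Fin k → WA s) (B : WA s) →
        PState As B → List (Fin s) → PState As B → Set
PStep As B (p , pb) x (q , qb) =
  (∀ i → δ* (As i) (p i) x ≡ q i) × (δ* B pb x ≡ qb)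

StronglyConnected : ∀ {s k} (As : Fin k → WA s) (B : WA s) → Set
StronglyConnected {s} As B =
  ∀ (p q : PState As B) → ∃ λ (x : List (Fin s)) → PStep As B p x q

-- Backwards, lim inf ≥ r implies lim sup ≥ r. Forwards, strong connectivity turns u into
-- cycles of the product automaton: read u up to a time t at which the average of B is almost
-- r_b and the averages of all A_i are almost r_i, then return to the initial product state
-- along a path whose length is bounded independently of t. For every ε this gives a nonempty
-- cycle C on which every automaton has average weight at least its threshold minus ε. The
-- word u′ repeats the cycle for ε = 1/(j+1) until the word read so far is long compared
-- with the next cycle and then moves on. Complete cycles then contribute slopes tending to
-- the thresholds, and a partial cycle is short compared with the preceding word, so its
-- weight, bounded below letter by letter, does not lower the averages in the limit.

module Submission where

open import Defs
open import Data.Nat using (ℕ)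
open import Data.Fin using (Fin)
open import Data.Rational using (ℚ)
open import Data.Product using (∃; _×_)
open import Function.Bundles using (_⇔_)

open import Data.Nat as ℕ using (zero; suc; _⊔_)
import Data.Nat.Properties as ℕ
import Data.Fin as Fin
import Data.Fin.Properties as Fin
open import Data.Integer as ℤ using (-[1+_]; +[1+_])
import Data.Integer.Properties as ℤ
open import Data.Rational using (0ℚ; 1ℚ; mkℚ; toℚᵘ; _+_; _-_; _*_; -_; _/_; _≤_; _<_; *≤*; *<*; nonNegative; positive)
open import Data.Rational.Properties
import Data.Rational.Unnormalised as ℚᵘ
import Data.Rational.Unnormalised.Properties as ℚᵘ
open import Data.Rational.Solver using (module +-*-Solver)
open import Data.List using (List; []; _∷_; _++_; _∷ʳ_; length; take; lookup)
import Data.List.Properties as List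
open import Data.Product using (Σ; ∃₂; _,_; proj₁; proj₂)
open import Data.Sum using (inj₁; inj₂)
open import Function using (_∘_)
open import Function.Bundles using (mk⇔; module Equivalence)
open import Relation.Binary.PropositionalEquality
open import Relation.Nullary using (¬_; yes; no; contradiction)

open +-*-Solver using (solve; _:+_; _:*_; _:-_; :-_; _:=_; con)

fromℕ : ℕ → ℚ
fromℕ zero    = 0ℚ
fromℕ (suc n) = 1ℚ + fromℕ n

fromℕ-+ : ∀ m n → fromℕ (m ℕ.+ n) ≡ fromℕ m + fromℕ n
fromℕ-+ zero    n = sym (+-identityˡ (fromℕ n))
fromℕ-+ (suc m) n = trans (cong (1ℚ +_) (fromℕ-+ m n)) (sym (+-assoc 1ℚ (fromℕ m) (fromℕ n)))

fromℕ-* : ∀ m n → fromℕ (m ℕ.* n) ≡ fromℕ m * fromℕ n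
fromℕ-* zero    n = sym (*-zeroˡ (fromℕ n))
fromℕ-* (suc m) n = begin
  fromℕ (n ℕ.+ m ℕ.* n)        ≡⟨ fromℕ-+ n (m ℕ.* n) ⟩
  fromℕ n + fromℕ (m ℕ.* n)    ≡⟨ cong (fromℕ n +_) (fromℕ-* m n) ⟩
  fromℕ n + fromℕ m * fromℕ n  ≡⟨ solve 2 (λ a b → b :+ a :* b := (con 1ℚ :+ a) :* b) refl (fromℕ m) (fromℕ n) ⟩
  (1ℚ + fromℕ m) * fromℕ n     ∎
  where open ≡-Reasoning

0≤fromℕ : ∀ n → 0ℚ ≤ fromℕ n
0≤fromℕ zero    = ≤-refl
0≤fromℕ (suc n) = +-mono-≤ {0ℚ} {1ℚ} (*≤* (ℤ.+≤+ ℕ.z≤n)) (0≤fromℕ n)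

fromℕ-mono-≤ : ∀ {m n} → m ℕ.≤ n → fromℕ m ≤ fromℕ n
fromℕ-mono-≤ {m} m≤n with ℕ.m≤n⇒∃[o]m+o≡n m≤n
... | o , refl = begin
  fromℕ m           ≡⟨ +-identityʳ (fromℕ m) ⟨
  fromℕ m + 0ℚ      ≤⟨ +-monoʳ-≤ (fromℕ m) (0≤fromℕ o) ⟩
  fromℕ m + fromℕ o ≡⟨ fromℕ-+ m o ⟨
  fromℕ (m ℕ.+ o)   ∎
  where open ≤-Reasoning

toℚᵘ-fromℕ : ∀ n → toℚᵘ (fromℕ n) ℚᵘ.≃ ℚᵘ.mkℚᵘ (ℤ.+ n) 0
toℚᵘ-fromℕ zero    = ℚᵘ.*≡* refl
toℚᵘ-fromℕ (suc n) = ℚᵘ.≃-trans (toℚᵘ-homo-+ 1ℚ (fromℕ n))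
  (ℚᵘ.≃-trans (ℚᵘ.+-congʳ (toℚᵘ 1ℚ) (toℚᵘ-fromℕ n)) (ℚᵘ.*≡* (cong (λ x → (ℤ.+ 1 ℤ.+ x) ℤ.* ℤ.+ 1) (ℤ.*-identityʳ (ℤ.+ n)))))

*-monoˡ-≤-0≤ : ∀ {r p q} → 0ℚ ≤ r → p ≤ q → r * p ≤ r * q
*-monoˡ-≤-0≤ {r} 0≤r = *-monoˡ-≤-nonNeg r {{nonNegative 0≤r}}

*-monoʳ-≤-0≤ : ∀ {r p q} → 0ℚ ≤ r → p ≤ q → p * r ≤ q * r
*-monoʳ-≤-0≤ {r} 0≤r = *-monoʳ-≤-nonNeg r {{nonNegative 0≤r}}

1/suc : ℕ → ℚ
1/suc n = ℤ.+ 1 / suc n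

toℚᵘ-1/suc : ∀ n → toℚᵘ (1/suc n) ℚᵘ.≃ ℚᵘ.mkℚᵘ (ℤ.+ 1) n
toℚᵘ-1/suc n = toℚᵘ-fromℚᵘ (ℚᵘ.mkℚᵘ (ℤ.+ 1) n)

fromℕ-suc*1/suc : ∀ n → fromℕ (suc n) * 1/suc n ≡ 1ℚ
fromℕ-suc*1/suc n = toℚᵘ-injective (ℚᵘ.≃-trans (toℚᵘ-homo-* (fromℕ (suc n)) (1/suc n))
  (ℚᵘ.≃-trans (ℚᵘ.*-cong (toℚᵘ-fromℕ (suc n)) (toℚᵘ-1/suc n)) (ℚᵘ.*≡* (cong ℤ.+_ nat-identity))))
  where
  nat-identity : suc n ℕ.* 1 ℕ.* 1 ≡ 1 ℕ.* (1 ℕ.* suc n)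
  nat-identity = trans (ℕ.*-identityʳ (suc n ℕ.* 1)) (trans (ℕ.*-identityʳ (suc n)) (sym (trans (ℕ.*-identityˡ (1 ℕ.* suc n)) (ℕ.*-identityˡ (suc n)))))

0<1/suc : ∀ n → 0ℚ < 1/suc n
0<1/suc n = toℚᵘ-cancel-< (ℚᵘ.<-respʳ-≃ (ℚᵘ.≃-sym (toℚᵘ-1/suc n)) (ℚᵘ.*<* (ℤ.+<+ (ℕ.s≤s ℕ.z≤n))))

1/suc-antimono-≤ : ∀ {m n} → m ℕ.≤ n → 1/suc n ≤ 1/suc m
1/suc-antimono-≤ {m} {n} m≤n = toℚᵘ-cancel-≤ (ℚᵘ.≤-respˡ-≃ (ℚᵘ.≃-sym (toℚᵘ-1/suc n))
  (ℚᵘ.≤-respʳ-≃ (ℚᵘ.≃-sym (toℚᵘ-1/suc m)) (ℚᵘ.*≤* (ℤ.*-monoˡ-≤-nonNeg (ℤ.+ 1) (ℤ.+≤+ (ℕ.s≤s m≤n))))))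

∃1/suc≤ : ∀ ε → 0ℚ < ε → ∃ λ d → 1/suc d ≤ ε
∃1/suc≤ (mkℚ +[1+ p ] d _) _ = d , toℚᵘ-cancel-≤ (ℚᵘ.≤-respˡ-≃ (ℚᵘ.≃-sym (toℚᵘ-1/suc d))
  (ℚᵘ.*≤* (ℤ.*-monoʳ-≤-nonNeg (ℤ.+ suc d) {ℤ.+ 1} {+[1+ p ]} (ℤ.+≤+ (ℕ.s≤s ℕ.z≤n)))))
∃1/suc≤ (mkℚ (ℤ.+ 0) _ _) (*<* (ℤ.+<+ ()))
∃1/suc≤ (mkℚ -[1+ _ ] _ _) (*<* ())

x*fromℕ-suc*1/suc : ∀ x n → x * fromℕ (suc n) * 1/suc n ≡ x
x*fromℕ-suc*1/suc x n = begin
  x * fromℕ (suc n) * 1/suc n   ≡⟨ *-assoc x (fromℕ (suc n)) (1/suc n) ⟩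
  x * (fromℕ (suc n) * 1/suc n) ≡⟨ cong (x *_) (fromℕ-suc*1/suc n) ⟩
  x * 1ℚ                        ≡⟨ *-identityʳ x ⟩
  x                             ∎
  where open ≡-Reasoning

≤*1/suc⇔ : ∀ c x n → c ≤ x * 1/suc n ⇔ fromℕ (suc n) * c ≤ x
≤*1/suc⇔ c x n = mk⇔
  (λ c≤ → begin
    fromℕ (suc n) * c                  ≤⟨ *-monoˡ-≤-0≤ (0≤fromℕ (suc n)) c≤ ⟩
    fromℕ (suc n) * (x * 1/suc n)      ≡⟨ solve 3 (λ a x e → a :* (x :* e) := x :* a :* e) refl (fromℕ (suc n)) x (1/suc n) ⟩
    x * fromℕ (suc n) * 1/suc n        ≡⟨ x*fromℕ-suc*1/suc x n ⟩
    x                                  ∎)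
  (λ ≤x → begin
    c                                  ≡⟨ x*fromℕ-suc*1/suc c n ⟨
    c * fromℕ (suc n) * 1/suc n        ≡⟨ cong (_* 1/suc n) (*-comm c (fromℕ (suc n))) ⟩
    fromℕ (suc n) * c * 1/suc n        ≤⟨ *-monoʳ-≤-0≤ (<⇒≤ (0<1/suc n)) ≤x ⟩
    x * 1/suc n                        ∎)
  where open ≤-Reasoning

upperℕ : ℚ → ℕ
upperℕ (mkℚ (ℤ.+ m)   _ _) = m
upperℕ (mkℚ -[1+ _ ] _ _) = 0

≤-upperℕ : ∀ q → q ≤ fromℕ (upperℕ q)
≤-upperℕ (mkℚ (ℤ.+ m) d _) = toℚᵘ-cancel-≤ (ℚᵘ.≤-respʳ-≃ (ℚᵘ.≃-sym (toℚᵘ-fromℕ m))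
  (ℚᵘ.*≤* (ℤ.*-monoˡ-≤-nonNeg (ℤ.+ m) (ℤ.+≤+ (ℕ.s≤s ℕ.z≤n)))))
≤-upperℕ (mkℚ -[1+ _ ] _ _) = *≤* ℤ.-≤+

-≤upperℕ : ∀ r {ε} → 0ℚ ≤ ε → r - ε ≤ fromℕ (upperℕ r)
-≤upperℕ r {ε} 0≤ε = begin
  r - ε         ≤⟨ +-monoʳ-≤ r (neg-antimono-≤ 0≤ε) ⟩
  r + - 0ℚ      ≡⟨ +-identityʳ r ⟩
  r             ≤⟨ ≤-upperℕ r ⟩
  fromℕ (upperℕ r) ∎
  where open ≤-Reasoning

archimedean : ∀ K δ → 0ℚ < δ → ∃ λ N → ∀ t → N ℕ.≤ t → K ≤ fromℕ t * δ
archimedean K δ 0<δ with ∃1/suc≤ δ 0<δ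
... | d , 1/suc-d≤δ = upperℕ K ℕ.* suc d , λ t N≤t → begin
  K                                        ≤⟨ ≤-upperℕ K ⟩
  fromℕ (upperℕ K)                         ≡⟨ x*fromℕ-suc*1/suc (fromℕ (upperℕ K)) d ⟨
  fromℕ (upperℕ K) * fromℕ (suc d) * 1/suc d ≡⟨ cong (_* 1/suc d) (fromℕ-* (upperℕ K) (suc d)) ⟨
  fromℕ (upperℕ K ℕ.* suc d) * 1/suc d     ≤⟨ *-monoʳ-≤-0≤ (<⇒≤ (0<1/suc d)) (fromℕ-mono-≤ N≤t) ⟩
  fromℕ t * 1/suc d                        ≤⟨ *-monoˡ-≤-0≤ (0≤fromℕ t) 1/suc-d≤δ ⟩
  fromℕ t * δ                              ∎
  where open ≤-Reasoning

fraction : ℚ → ℕ → ℚ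
fraction ε n = ε * 1/suc n

0<fraction : ∀ {ε} n → 0ℚ < ε → 0ℚ < fraction ε n
0<fraction {ε} n 0<ε = positive⁻¹ (fraction ε n) {{pos*pos⇒pos ε {{positive 0<ε}} (1/suc n) {{positive (0<1/suc n)}}}}

fraction-complement : ∀ ε n → ε - fraction ε n ≡ fraction ε n * fromℕ n
fraction-complement ε n = begin
  ε - η                                ≡⟨ cong (_- η) (x*fromℕ-suc*1/suc ε n) ⟨
  ε * fromℕ (suc n) * 1/suc n - η      ≡⟨ solve 4 (λ ε m e η → ε :* (con 1ℚ :+ m) :* e :- η := ε :* e :* m :+ (ε :* e :- η)) refl ε (fromℕ n) (1/suc n) η ⟩
  η * fromℕ n + (η - η)                ≡⟨ cong (η * fromℕ n +_) (+-inverseʳ η) ⟩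
  η * fromℕ n + 0ℚ                     ≡⟨ +-identityʳ (η * fromℕ n) ⟩
  η * fromℕ n                          ∎
  where open ≡-Reasoning
        η = fraction ε n

half-complement : ∀ ε → ε - fraction ε 1 ≡ fraction ε 1
half-complement ε = trans (fraction-complement ε 1) (trans (cong (fraction ε 1 *_) (+-identityʳ 1ℚ)) (*-identityʳ (fraction ε 1)))

mono-from : ∀ (a : ℕ → ℚ) M → (∀ m → M ℕ.≤ m → a m ≤ a (suc m)) → ∀ m → M ℕ.≤ m → a M ≤ a m
mono-from a M step zero    ℕ.z≤n = ≤-refl
mono-from a M step (suc m) M≤1+m with ℕ.m≤n⇒m<n∨m≡n M≤1+m
... | inj₁ (ℕ.s≤s M≤m) = ≤-trans (mono-from a M step m M≤m) (step m M≤m)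
... | inj₂ refl        = ≤-refl

slope-append : ∀ {L o S P K r ε η W R} → 0ℚ ≤ o → r - ε ≤ R →
  L * (r - η) ≤ S + K → - (o * W) ≤ P → o * (W + R) ≤ L * (ε - η) →
  (L + o) * (r - ε) ≤ (S + P) + K
slope-append {L} {o} {S} {P} {K} {r} {ε} {η} {W} {R} 0≤o r-ε≤R prefix suffix short = begin
  (L + o) * (r - ε)                                ≡⟨ solve 5 (λ L o r ε η → (L :+ o) :* (r :- ε) := L :* (r :- η) :+ o :* (r :- ε) :- L :* (ε :- η)) refl L o r ε η ⟩
  L * (r - η) + o * (r - ε) - L * (ε - η)          ≤⟨ +-monoˡ-≤ (- (L * (ε - η))) (+-mono-≤ prefix (*-monoˡ-≤-0≤ 0≤o r-ε≤R)) ⟩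
  (S + K) + o * R - L * (ε - η)                    ≡⟨ solve 6 (λ S K o W R g → (S :+ K) :+ o :* R :- g := (S :+ K) :+ (o :* (W :+ R) :+ (:- (o :* W))) :- g) refl S K o W R (L * (ε - η)) ⟩
  (S + K) + (o * (W + R) + - (o * W)) - L * (ε - η) ≤⟨ +-monoˡ-≤ (- (L * (ε - η))) (+-monoʳ-≤ (S + K) (+-mono-≤ short suffix)) ⟩
  (S + K) + (L * (ε - η) + P) - L * (ε - η)        ≡⟨ solve 4 (λ S K P g → (S :+ K) :+ (g :+ P) :- g := (S :+ P) :+ K) refl S K P (L * (ε - η)) ⟩
  (S + P) + K                                      ∎
  where open ≤-Reasoning

⨆ : ∀ n → (Fin n → ℕ) → ℕ
⨆ zero    f = 0
⨆ (suc n) f = f Fin.zero ⊔ ⨆ n (f ∘ Fin.suc)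

≤-⨆ : ∀ {n} f (i : Fin n) → f i ℕ.≤ ⨆ n f
≤-⨆ f Fin.zero    = ℕ.m≤m⊔n _ _
≤-⨆ f (Fin.suc i) = ℕ.≤-trans (≤-⨆ (f ∘ Fin.suc) i) (ℕ.m≤n⊔m _ _)

cons : ∀ {k} {n : Fin (suc k) → ℕ} → Fin (n Fin.zero) → ((i : Fin k) → Fin (n (Fin.suc i))) → (i : Fin (suc k)) → Fin (n i)
cons a g Fin.zero    = a
cons a g (Fin.suc i) = g i

⨆Π : ∀ k (n : Fin k → ℕ) → (((i : Fin k) → Fin (n i)) → ℕ) → ℕ
⨆Π zero    n F = F (λ ())
⨆Π (suc k) n F = ⨆ (n Fin.zero) λ a → ⨆Π k (n ∘ Fin.suc) λ g → F (cons a g)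

-- ⨆Π bounds F only on the tuples it enumerates; without function extensionality these are
-- merely pointwise equal to a given f.
≤-⨆Π : ∀ k n F (f : (i : Fin k) → Fin (n i)) → ∃ λ g → (∀ i → g i ≡ f i) × F g ℕ.≤ ⨆Π k n F
≤-⨆Π zero    n F f = (λ ()) , (λ ()) , ℕ.≤-refl
≤-⨆Π (suc k) n F f with ≤-⨆Π k (n ∘ Fin.suc) (λ g → F (cons (f Fin.zero) g)) (f ∘ Fin.suc)
... | g , g≗f , F≤ = cons (f Fin.zero) g , agree , ℕ.≤-trans F≤ (≤-⨆ (λ a → ⨆Π k (n ∘ Fin.suc) λ g → F (cons a g)) (f Fin.zero))
  where
  agree : ∀ i → cons (f Fin.zero) g i ≡ f i
  agree Fin.zero    = refl
  agree (Fin.suc i) = g≗f i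

module _ {s} (A : WA s) where

  wsum : Fin (nQ A) → List (Fin s) → ℚ
  wsum q []       = 0ℚ
  wsum q (a ∷ xs) = w A q a + wsum (δ A q a) xs

  δ*-++ : ∀ q xs ys → δ* A q (xs ++ ys) ≡ δ* A (δ* A q xs) ys
  δ*-++ q []       ys = refl
  δ*-++ q (a ∷ xs) ys = δ*-++ (δ A q a) xs ys

  wsum-++ : ∀ q xs ys → wsum q (xs ++ ys) ≡ wsum q xs + wsum (δ* A q xs) ys
  wsum-++ q []       ys = sym (+-identityˡ (wsum q ys))
  wsum-++ q (a ∷ xs) ys = trans (cong (w A q a +_) (wsum-++ (δ A q a) xs ys))
                                (sym (+-assoc (w A q a) _ _))

  wsum-∷ʳ : ∀ q xs a → wsum q (xs ∷ʳ a) ≡ wsum q xs + w A (δ* A q xs) a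
  wsum-∷ʳ q xs a = trans (wsum-++ q xs (a ∷ [])) (cong (wsum q xs +_) (+-identityʳ _))

  weightBound : ℕ
  weightBound = ⨆ (nQ A) λ q → ⨆ s λ a → upperℕ (- w A q a)

  -weightBound≤w : ∀ q a → - fromℕ weightBound ≤ w A q a
  -weightBound≤w q a = begin
    - fromℕ weightBound      ≤⟨ neg-antimono-≤ (fromℕ-mono-≤ (ℕ.≤-trans (≤-⨆ _ a) (≤-⨆ _ q))) ⟩
    - fromℕ (upperℕ (- w A q a)) ≤⟨ neg-antimono-≤ (≤-upperℕ (- w A q a)) ⟩
    - - w A q a              ≡⟨ solve 1 (λ x → :- (:- x) := x) refl (w A q a) ⟩
    w A q a                  ∎
    where open ≤-Reasoning

  -length*weightBound≤wsum : ∀ q xs → - (fromℕ (length xs) * fromℕ weightBound) ≤ wsum q xs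
  -length*weightBound≤wsum q []       = ≤-reflexive (cong -_ (*-zeroˡ (fromℕ weightBound)))
  -length*weightBound≤wsum q (a ∷ xs) = begin
    - ((1ℚ + fromℕ (length xs)) * W)   ≡⟨ solve 2 (λ n W → :- ((con 1ℚ :+ n) :* W) := (:- W) :+ (:- (n :* W))) refl (fromℕ (length xs)) W ⟩
    - W + - (fromℕ (length xs) * W)    ≤⟨ +-mono-≤ (-weightBound≤w q a) (-length*weightBound≤wsum (δ A q a) xs) ⟩
    w A q a + wsum (δ A q a) xs        ∎
    where open ≤-Reasoning
          W = fromℕ weightBound

prefix : ∀ {s} → Word s → ℕ → List (Fin s)
prefix u zero    = []
prefix u (suc n) = prefix u n ∷ʳ u n

length-prefix : ∀ {s} (u : Word s) n → length (prefix u n) ≡ n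
length-prefix u zero    = refl
length-prefix u (suc n) = trans (List.length-++ (prefix u n)) (trans (cong (ℕ._+ 1) (length-prefix u n)) (ℕ.+-comm n 1))

module _ {s} (A : WA s) (u : Word s) where

  δ*-prefix : ∀ n → δ* A (qI A) (prefix u n) ≡ run A u n
  δ*-prefix zero    = refl
  δ*-prefix (suc n) = trans (δ*-++ A (qI A) (prefix u n) (u n ∷ [])) (cong (λ q → δ A q (u n)) (δ*-prefix n))

  wsum-prefix : ∀ n → wsum A (qI A) (prefix u n) ≡ psum A u n
  wsum-prefix zero    = refl
  wsum-prefix (suc n) = begin
    wsum A (qI A) (prefix u n ∷ʳ u n)                                   ≡⟨ wsum-∷ʳ A (qI A) (prefix u n) (u n) ⟩
    wsum A (qI A) (prefix u n) + w A (δ* A (qI A) (prefix u n)) (u n)  ≡⟨ cong₂ (λ p q → p + w A q (u n)) (wsum-prefix n) (δ*-prefix n) ⟩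
    psum A u n + weight A u n                                           ∎
    where open ≡-Reasoning

-- Average weights as slopes

SlopeAtLeast : (ℕ → ℚ) → ℚ → Set
SlopeAtLeast f r = ∀ ε → 0ℚ < ε → ∃ λ N → ∀ t → N ℕ.≤ t → fromℕ t * (r - ε) ≤ f t

slope⇔liminf : ∀ {s} (A : WA s) u r → SlopeAtLeast (psum A u) r ⇔ LimInfAvg≥ A u r
slope⇔liminf A u r = mk⇔ to from
  where
  to : SlopeAtLeast (psum A u) r → LimInfAvg≥ A u r
  to slope ε 0<ε with slope ε 0<ε
  ... | N , h = N , λ n N≤n →
    Equivalence.from (≤*1/suc⇔ (r - ε) (psum A u (suc n)) n) (h (suc n) (ℕ.m≤n⇒m≤1+n N≤n))
  from : LimInfAvg≥ A u r → SlopeAtLeast (psum A u) r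
  from liminf ε 0<ε with liminf ε 0<ε
  ... | N , h = suc N , λ { (suc n) (ℕ.s≤s N≤n) →
    Equivalence.to (≤*1/suc⇔ (r - ε) (psum A u (suc n)) n) (h n N≤n) }

limsup⇒often : ∀ {s} (A : WA s) u r → LimSupAvg≥ A u r →
  ∀ ε → 0ℚ < ε → ∀ N → ∃ λ t → N ℕ.≤ t × fromℕ t * (r - ε) ≤ psum A u t
limsup⇒often A u r limsup ε 0<ε N with limsup ε 0<ε N
... | n , N≤n , h = suc n , ℕ.m≤n⇒m≤1+n N≤n , Equivalence.to (≤*1/suc⇔ (r - ε) (psum A u (suc n)) n) h

liminf⇒limsup : ∀ {s} (A : WA s) u r → LimInfAvg≥ A u r → LimSupAvg≥ A u r
liminf⇒limsup A u r liminf ε 0<ε N with liminf ε 0<ε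
... | N′ , h = N ⊔ N′ , ℕ.m≤m⊔n N N′ , h (N ⊔ N′) (ℕ.m≤n⊔m N N′)

slope-up-to-constant : ∀ {f r} → (∀ ε → 0ℚ < ε → ∃₂ λ N K → ∀ t → N ℕ.≤ t → fromℕ t * (r - ε) ≤ f t + K) →
  SlopeAtLeast f r
slope-up-to-constant {f} {r} slope+K ε 0<ε = absorb (slope+K η 0<η)
  where
  η = fraction ε 1
  0<η = 0<fraction 1 0<ε
  absorb : (∃₂ λ N K → ∀ t → N ℕ.≤ t → fromℕ t * (r - η) ≤ f t + K) → ∃ λ N → ∀ t → N ℕ.≤ t → fromℕ t * (r - ε) ≤ f t
  absorb (N , K , h) = N ⊔ N′ , λ t N⊔N′≤t → begin
    fromℕ t * (r - ε)                     ≡⟨ solve 4 (λ t r ε η → t :* (r :- ε) := t :* (r :- η) :- t :* (ε :- η)) refl (fromℕ t) r ε η ⟩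
    fromℕ t * (r - η) - fromℕ t * (ε - η) ≤⟨ +-mono-≤ (h t (ℕ.m⊔n≤o⇒m≤o N N′ N⊔N′≤t)) (neg-antimono-≤ (K≤ t (ℕ.m⊔n≤o⇒n≤o N N′ N⊔N′≤t))) ⟩
    f t + K - K                           ≡⟨ trans (+-assoc (f t) K (- K)) (trans (cong (f t +_) (+-inverseʳ K)) (+-identityʳ (f t))) ⟩
    f t                                   ∎
    where
    open ≤-Reasoning
    N′ = proj₁ (archimedean K (ε - η) (subst (0ℚ <_) (sym (half-complement ε)) 0<η))
    K≤ = proj₂ (archimedean K (ε - η) (subst (0ℚ <_) (sym (half-complement ε)) 0<η))

-- Concatenations of cycles

module Concatenation {s} (block : ℕ → List (Fin s)) (nonempty : ∀ m → 0 ℕ.< length (block m)) where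

  blockStart : ℕ → ℕ
  blockStart zero    = 0
  blockStart (suc m) = blockStart m ℕ.+ length (block m)

  blockStart-mono-≤ : ∀ {m n} → m ℕ.≤ n → blockStart m ℕ.≤ blockStart n
  blockStart-mono-≤ {m} {n} m≤n with ℕ.m≤n⇒∃[o]m+o≡n m≤n
  ... | o , refl = go o
    where
    go : ∀ o → blockStart m ℕ.≤ blockStart (m ℕ.+ o)
    go zero    = ℕ.≤-reflexive (cong blockStart (sym (ℕ.+-identityʳ m)))
    go (suc o) = ℕ.≤-trans (go o) (ℕ.≤-trans (ℕ.m≤m+n _ _) (ℕ.≤-reflexive (cong blockStart (sym (ℕ.+-suc m o)))))

  n≤blockStart : ∀ n → n ℕ.≤ blockStart n
  n≤blockStart zero    = ℕ.z≤n
  n≤blockStart (suc n) = ℕ.≤-trans (ℕ.≤-reflexive (ℕ.+-comm 1 n)) (ℕ.+-mono-≤ (n≤blockStart n) (nonempty n))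

  Position : Set
  Position = Σ ℕ λ m → Fin (length (block m))

  first : ∀ m → Fin (length (block m))
  first m = Fin.fromℕ< (nonempty m)

  next : Position → Position
  next (m , i) with suc (Fin.toℕ i) ℕ.<? length (block m)
  ... | yes i+1<ℓ = m , Fin.fromℕ< i+1<ℓ
  ... | no  _     = suc m , first (suc m)

  position : ℕ → Position
  position zero    = 0 , first 0
  position (suc t) = next (position t)

  letter : Position → Fin s
  letter (m , i) = lookup (block m) i

  word : Word s
  word t = letter (position t)

  time : Position → ℕ
  time (m , i) = blockStart m ℕ.+ Fin.toℕ i

  time-next : ∀ p → time (next p) ≡ suc (time p)
  time-next (m , i) with suc (Fin.toℕ i) ℕ.<? length (block m)
  ... | yes i+1<ℓ = trans (cong (blockStart m ℕ.+_) (Fin.toℕ-fromℕ< i+1<ℓ)) (ℕ.+-suc (blockStart m) (Fin.toℕ i))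
  ... | no  i+1≮ℓ = begin
    blockStart m ℕ.+ length (block m) ℕ.+ Fin.toℕ (first (suc m)) ≡⟨ cong (blockStart m ℕ.+ length (block m) ℕ.+_) (Fin.toℕ-fromℕ< (nonempty (suc m))) ⟩
    blockStart m ℕ.+ length (block m) ℕ.+ 0                       ≡⟨ ℕ.+-identityʳ _ ⟩
    blockStart m ℕ.+ length (block m)                             ≡⟨ cong (blockStart m ℕ.+_) (ℕ.≤-antisym (Fin.toℕ<n i) (ℕ.≮⇒≥ i+1≮ℓ)) ⟨
    blockStart m ℕ.+ suc (Fin.toℕ i)                              ≡⟨ ℕ.+-suc (blockStart m) (Fin.toℕ i) ⟩
    suc (blockStart m ℕ.+ Fin.toℕ i)                              ∎
    where open ≡-Reasoning

  time-position : ∀ t → time (position t) ≡ t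
  time-position zero    = Fin.toℕ-fromℕ< (nonempty 0)
  time-position (suc t) = trans (time-next (position t)) (cong suc (time-position t))

  blockStart≤⇒≤block : ∀ t {M} → blockStart M ℕ.≤ t → M ℕ.≤ proj₁ (position t)
  blockStart≤⇒≤block t {M} blockStart-M≤t with position t | time-position t | M ℕ.≤? proj₁ (position t)
  ... | m , i | t≡ | yes M≤m = M≤m
  ... | m , i | refl | no M≰m = contradiction blockStart-M≤t (ℕ.<⇒≱ (begin-strict
    blockStart m ℕ.+ Fin.toℕ i          <⟨ ℕ.+-monoʳ-< (blockStart m) (Fin.toℕ<n i) ⟩
    blockStart (suc m)                  ≤⟨ blockStart-mono-≤ (ℕ.≰⇒> M≰m) ⟩
    blockStart M                        ∎))
    where open ℕ.≤-Reasoning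

  take-first : ∀ m → take (Fin.toℕ (first m)) (block m) ≡ []
  take-first m = cong (λ n → take n (block m)) (Fin.toℕ-fromℕ< (nonempty m))

  take-last : ∀ m (i : Fin (length (block m))) → ¬ (suc (Fin.toℕ i) ℕ.< length (block m)) →
    take (suc (Fin.toℕ i)) (block m) ≡ block m
  take-last m i i+1≮ℓ = List.take-all (suc (Fin.toℕ i)) (block m) (ℕ.≮⇒≥ i+1≮ℓ)

  module _ (X : WA s) (cycle : ∀ m → δ* X (qI X) (block m) ≡ qI X) where

    blockSum : ℕ → ℚ
    blockSum zero    = 0ℚ
    blockSum (suc m) = blockSum m + wsum X (qI X) (block m)

    stateAt : Position → Fin (nQ X)
    stateAt (m , i) = δ* X (qI X) (take (Fin.toℕ i) (block m))

    valueAt : Position → ℚ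
    valueAt (m , i) = blockSum m + wsum X (qI X) (take (Fin.toℕ i) (block m))

    δ*-take-suc : ∀ m i → δ* X (qI X) (take (suc (Fin.toℕ i)) (block m)) ≡ δ X (stateAt (m , i)) (letter (m , i))
    δ*-take-suc m i = trans (cong (δ* X (qI X)) (List.take-suc (block m) i))
                            (δ*-++ X (qI X) (take (Fin.toℕ i) (block m)) (letter (m , i) ∷ []))

    wsum-take-suc : ∀ m i → wsum X (qI X) (take (suc (Fin.toℕ i)) (block m)) ≡
                            wsum X (qI X) (take (Fin.toℕ i) (block m)) + w X (stateAt (m , i)) (letter (m , i))
    wsum-take-suc m i = trans (cong (wsum X (qI X)) (List.take-suc (block m) i))
                              (wsum-∷ʳ X (qI X) (take (Fin.toℕ i) (block m)) (letter (m , i)))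

    stateAt-next : ∀ p → stateAt (next p) ≡ δ X (stateAt p) (letter p)
    stateAt-next (m , i) with suc (Fin.toℕ i) ℕ.<? length (block m)
    ... | yes i+1<ℓ = trans (cong (λ n → δ* X (qI X) (take n (block m))) (Fin.toℕ-fromℕ< i+1<ℓ)) (δ*-take-suc m i)
    ... | no  i+1≮ℓ = begin
      δ* X (qI X) (take (Fin.toℕ (first (suc m))) (block (suc m))) ≡⟨ cong (δ* X (qI X)) (take-first (suc m)) ⟩
      qI X                                                        ≡⟨ cycle m ⟨
      δ* X (qI X) (block m)                                       ≡⟨ cong (δ* X (qI X)) (take-last m i i+1≮ℓ) ⟨
      δ* X (qI X) (take (suc (Fin.toℕ i)) (block m))              ≡⟨ δ*-take-suc m i ⟩
      δ X (stateAt (m , i)) (letter (m , i))                      ∎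
      where open ≡-Reasoning

    valueAt-next : ∀ p → valueAt (next p) ≡ valueAt p + w X (stateAt p) (letter p)
    valueAt-next (m , i) with suc (Fin.toℕ i) ℕ.<? length (block m)
    ... | yes i+1<ℓ = begin
      blockSum m + wsum X (qI X) (take (Fin.toℕ (Fin.fromℕ< i+1<ℓ)) (block m)) ≡⟨ cong (λ n → blockSum m + wsum X (qI X) (take n (block m))) (Fin.toℕ-fromℕ< i+1<ℓ) ⟩
      blockSum m + wsum X (qI X) (take (suc (Fin.toℕ i)) (block m))            ≡⟨ cong (blockSum m +_) (wsum-take-suc m i) ⟩
      blockSum m + (wsum X (qI X) (take (Fin.toℕ i) (block m)) + w X (stateAt (m , i)) (letter (m , i))) ≡⟨ +-assoc (blockSum m) _ _ ⟨
      valueAt (m , i) + w X (stateAt (m , i)) (letter (m , i))                 ∎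
      where open ≡-Reasoning
    ... | no  i+1≮ℓ = begin
      blockSum (suc m) + wsum X (qI X) (take (Fin.toℕ (first (suc m))) (block (suc m))) ≡⟨ cong (λ xs → blockSum (suc m) + wsum X (qI X) xs) (take-first (suc m)) ⟩
      blockSum (suc m) + 0ℚ                                                    ≡⟨ +-identityʳ (blockSum (suc m)) ⟩
      blockSum m + wsum X (qI X) (block m)                                     ≡⟨ cong (λ xs → blockSum m + wsum X (qI X) xs) (take-last m i i+1≮ℓ) ⟨
      blockSum m + wsum X (qI X) (take (suc (Fin.toℕ i)) (block m))            ≡⟨ cong (blockSum m +_) (wsum-take-suc m i) ⟩
      blockSum m + (wsum X (qI X) (take (Fin.toℕ i) (block m)) + w X (stateAt (m , i)) (letter (m , i))) ≡⟨ +-assoc (blockSum m) _ _ ⟨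
      valueAt (m , i) + w X (stateAt (m , i)) (letter (m , i))                 ∎
      where open ≡-Reasoning

    run-position : ∀ t → run X word t ≡ stateAt (position t)
    run-position zero    = cong (δ* X (qI X)) (sym (take-first 0))
    run-position (suc t) = trans (cong (λ q → δ X q (word t)) (run-position t)) (sym (stateAt-next (position t)))

    psum-position : ∀ t → psum X word t ≡ valueAt (position t)
    psum-position zero    = sym (trans (cong (λ xs → 0ℚ + wsum X (qI X) xs) (take-first 0)) (+-identityˡ 0ℚ))
    psum-position (suc t) = begin
      psum X word t + w X (run X word t) (word t)               ≡⟨ cong₂ (λ v q → v + w X q (word t)) (psum-position t) (run-position t) ⟩
      valueAt (position t) + w X (stateAt (position t)) (word t) ≡⟨ valueAt-next (position t) ⟨
      valueAt (position (suc t))                                 ∎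
      where open ≡-Reasoning

    blockSum-slope : ∀ c M → (∀ m → M ℕ.≤ m → fromℕ (length (block m)) * c ≤ wsum X (qI X) (block m)) →
      ∀ m → M ℕ.≤ m → fromℕ (blockStart m) * c ≤ blockSum m + (fromℕ (blockStart M) * c - blockSum M)
    blockSum-slope c M slopes m M≤m = begin
      L m                             ≡⟨ solve 2 (λ L S → L := S :- (S :- L)) refl (L m) (blockSum m) ⟩
      blockSum m - a m                ≤⟨ +-monoʳ-≤ (blockSum m) (neg-antimono-≤ (mono-from a M a-step m M≤m)) ⟩
      blockSum m - a M                ≡⟨ solve 3 (λ S L′ S′ → S :- (S′ :- L′) := S :+ (L′ :- S′)) refl (blockSum m) (L M) (blockSum M) ⟩
      blockSum m + (L M - blockSum M) ∎
      where
      open ≤-Reasoning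
      L : ℕ → ℚ
      L m = fromℕ (blockStart m) * c
      a : ℕ → ℚ
      a m = blockSum m - L m
      a-step : ∀ m → M ℕ.≤ m → a m ≤ a (suc m)
      a-step m M≤m = begin
        blockSum m - L m                                   ≡⟨ solve 3 (λ S L l → S :- L := (S :+ l) :- (L :+ l)) refl (blockSum m) (L m) (ℓc m) ⟩
        (blockSum m + ℓc m) - (L m + ℓc m)                 ≤⟨ +-monoˡ-≤ (- (L m + ℓc m)) (+-monoʳ-≤ (blockSum m) (slopes m M≤m)) ⟩
        blockSum (suc m) - (L m + ℓc m)                    ≡⟨ cong (λ x → blockSum (suc m) - x) L-step ⟨
        blockSum (suc m) - L (suc m)                       ∎
        where
        ℓc : ℕ → ℚ
        ℓc m = fromℕ (length (block m)) * c
        L-step : L (suc m) ≡ L m + ℓc m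
        L-step = trans (cong (_* c) (fromℕ-+ (blockStart m) (length (block m))))
                       (*-distribʳ-+ c (fromℕ (blockStart m)) (fromℕ (length (block m))))

    within-block : ∀ r ε η {K} R m (i : Fin (length (block m))) → r - ε ≤ fromℕ R →
      fromℕ (blockStart m) * (r - η) ≤ blockSum m + K →
      fromℕ (length (block m)) * fromℕ (weightBound X ℕ.+ R) ≤ fromℕ (blockStart m) * (ε - η) →
      fromℕ (time (m , i)) * (r - ε) ≤ valueAt (m , i) + K
    within-block r ε η {K} R m i r-ε≤R prefix short =
      subst (λ x → x * (r - ε) ≤ valueAt (m , i) + K) (sym (fromℕ-+ (blockStart m) o))
        (slope-append {L = fromℕ (blockStart m)} {S = blockSum m} {r = r} {ε} {η} (0≤fromℕ o) r-ε≤R prefix suffix short-o)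
      where
      o = Fin.toℕ i
      W = fromℕ (weightBound X)
      length-take-o : length (take o (block m)) ≡ o
      length-take-o = trans (List.length-take o (block m)) (ℕ.m≤n⇒m⊓n≡m (ℕ.<⇒≤ (Fin.toℕ<n i)))
      suffix : - (fromℕ o * W) ≤ wsum X (qI X) (take o (block m))
      suffix = subst (λ n → - (fromℕ n * W) ≤ wsum X (qI X) (take o (block m))) length-take-o
                     (-length*weightBound≤wsum X (qI X) (take o (block m)))
      short-o : fromℕ o * (W + fromℕ R) ≤ fromℕ (blockStart m) * (ε - η)
      short-o = begin
        fromℕ o * (W + fromℕ R)                      ≡⟨ cong (fromℕ o *_) (fromℕ-+ (weightBound X) R) ⟨
        fromℕ o * fromℕ (weightBound X ℕ.+ R)        ≤⟨ *-monoʳ-≤-0≤ (0≤fromℕ (weightBound X ℕ.+ R)) (fromℕ-mono-≤ (ℕ.<⇒≤ (Fin.toℕ<n i))) ⟩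
        fromℕ (length (block m)) * fromℕ (weightBound X ℕ.+ R) ≤⟨ short ⟩
        fromℕ (blockStart m) * (ε - η)               ∎
        where open ≤-Reasoning

    concat-slope : ∀ r →
      (∀ ε → 0ℚ < ε → ∃ λ M → ∀ m → M ℕ.≤ m → fromℕ (length (block m)) * (r - ε) ≤ wsum X (qI X) (block m)) →
      (∀ η → 0ℚ < η → ∃ λ M → ∀ m → M ℕ.≤ m → fromℕ (length (block m)) ≤ fromℕ (blockStart m) * η) →
      SlopeAtLeast (psum X word) r
    concat-slope r slopes short = slope-up-to-constant {psum X word} {r} bound
      where
      C = weightBound X ℕ.+ upperℕ r
      bound : ∀ ε → 0ℚ < ε → ∃₂ λ N K → ∀ t → N ℕ.≤ t → fromℕ t * (r - ε) ≤ psum X word t + K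
      bound ε 0<ε = combine (slopes η 0<η) (short η 0<η)
        where
        η = fraction ε C
        0<η = 0<fraction C 0<ε
        combine : (∃ λ M → ∀ m → M ℕ.≤ m → fromℕ (length (block m)) * (r - η) ≤ wsum X (qI X) (block m)) →
                  (∃ λ M → ∀ m → M ℕ.≤ m → fromℕ (length (block m)) ≤ fromℕ (blockStart m) * η) →
                  ∃₂ λ N K → ∀ t → N ℕ.≤ t → fromℕ t * (r - ε) ≤ psum X word t + K
        combine (M₁ , slopes-M₁) (M₂ , short-M₂) = blockStart M , K , λ t N≤t →
          subst₂ (λ x y → fromℕ x * (r - ε) ≤ y + K) (time-position t) (sym (psum-position t))
                 (in-block (position t) (blockStart≤⇒≤block t N≤t))
          where
          M = M₁ ⊔ M₂
          K = fromℕ (blockStart M) * (r - η) - blockSum M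
          in-block : ∀ p → M ℕ.≤ proj₁ p → fromℕ (time p) * (r - ε) ≤ valueAt p + K
          in-block (m , i) M≤m = within-block r ε η (upperℕ r) m i (-≤upperℕ r (<⇒≤ 0<ε))
            (blockSum-slope (r - η) M (λ m′ M≤m′ → slopes-M₁ m′ (ℕ.≤-trans (ℕ.m≤m⊔n M₁ M₂) M≤m′)) m M≤m)
            (begin
              fromℕ (length (block m)) * fromℕ C       ≤⟨ *-monoʳ-≤-0≤ (0≤fromℕ C) (short-M₂ m (ℕ.≤-trans (ℕ.m≤n⊔m M₁ M₂) M≤m)) ⟩
              fromℕ (blockStart m) * η * fromℕ C       ≡⟨ *-assoc (fromℕ (blockStart m)) η (fromℕ C) ⟩
              fromℕ (blockStart m) * (η * fromℕ C)     ≡⟨ cong (fromℕ (blockStart m) *_) (fraction-complement ε C) ⟨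
              fromℕ (blockStart m) * (ε - η)           ∎)
            where open ≤-Reasoning

CycleWithSlope : ∀ {s} (X : WA s) → ℚ → List (Fin s) → Set
CycleWithSlope X c xs = δ* X (qI X) xs ≡ qI X × fromℕ (length xs) * c ≤ wsum X (qI X) xs

module Schedule {s} (C : ℕ → List (Fin s)) (nonempty : ∀ j → 0 ℕ.< length (C j)) where

  -- The phase moves from j to j + 1 once (j + 1)·|C (j + 1)| blocks
  -- have been read, so each block is at most a 1/phase fraction of the word before it while
  -- the phase still grows without bound.
  threshold : ℕ → ℕ
  threshold j = suc j ℕ.* length (C (suc j))

  advance : ℕ → ℕ → ℕ
  advance j m with threshold j ℕ.≤? m
  ... | yes _ = suc j
  ... | no  _ = j

  ≤-advance : ∀ j m → j ℕ.≤ advance j m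
  ≤-advance j m with threshold j ℕ.≤? m
  ... | yes _ = ℕ.n≤1+n j
  ... | no  _ = ℕ.≤-refl

  advance-threshold : ∀ j m → threshold j ℕ.≤ m → advance j m ≡ suc j
  advance-threshold j m reached with threshold j ℕ.≤? m
  ... | yes _          = refl
  ... | no  unreached = contradiction reached unreached

  advance-invariant : ∀ j m → j ℕ.* length (C j) ℕ.≤ m → advance j m ℕ.* length (C (advance j m)) ℕ.≤ suc m
  advance-invariant j m inv with threshold j ℕ.≤? m
  ... | yes reached = ℕ.m≤n⇒m≤1+n reached
  ... | no  _       = ℕ.m≤n⇒m≤1+n inv

  phase : ℕ → ℕ
  phase zero    = 0
  phase (suc m) = advance (phase m) m

  phase-invariant : ∀ m → phase m ℕ.* length (C (phase m)) ℕ.≤ m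
  phase-invariant zero    = ℕ.z≤n
  phase-invariant (suc m) = advance-invariant (phase m) m (phase-invariant m)

  phase-mono-≤ : ∀ {m n} → m ℕ.≤ n → phase m ℕ.≤ phase n
  phase-mono-≤ {m} {n} m≤n with ℕ.m≤n⇒∃[o]m+o≡n m≤n
  ... | o , refl = go o
    where
    go : ∀ o → phase m ℕ.≤ phase (m ℕ.+ o)
    go zero    = ℕ.≤-reflexive (cong phase (sym (ℕ.+-identityʳ m)))
    go (suc o) = ℕ.≤-trans (go o) (ℕ.≤-trans (≤-advance (phase (m ℕ.+ o)) (m ℕ.+ o))
                                            (ℕ.≤-reflexive (cong phase (sym (ℕ.+-suc m o)))))

  phase-escapes : ∀ m → phase m ℕ.< phase (suc (m ⊔ threshold (phase m)))
  phase-escapes m with ℕ.m≤n⇒m<n∨m≡n (phase-mono-≤ {m} {m′} (ℕ.m≤m⊔n m (threshold (phase m))))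
    where m′ = m ⊔ threshold (phase m)
  ... | inj₁ grown = ℕ.≤-trans grown (≤-advance (phase m′) m′)
    where m′ = m ⊔ threshold (phase m)
  ... | inj₂ stuck = ℕ.≤-reflexive (sym (trans (advance-threshold (phase m′) m′ reached) (cong suc (sym stuck))))
    where
    m′ = m ⊔ threshold (phase m)
    reached : threshold (phase m′) ℕ.≤ m′
    reached = subst (λ j → threshold j ℕ.≤ m′) stuck (ℕ.m≤n⊔m m (threshold (phase m)))

  phase-unbounded : ∀ J → ∃ λ m → J ℕ.≤ phase m
  phase-unbounded zero    = 0 , ℕ.z≤n
  phase-unbounded (suc J) with phase-unbounded J
  ... | m , J≤phase-m = _ , ℕ.≤-trans (ℕ.s≤s J≤phase-m) (phase-escapes m)

  eventually-phase≥ : ∀ J → ∃ λ M → ∀ m → M ℕ.≤ m → J ℕ.≤ phase m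
  eventually-phase≥ J with phase-unbounded J
  ... | M , J≤phase-M = M , λ m M≤m → ℕ.≤-trans J≤phase-M (phase-mono-≤ M≤m)

  block : ℕ → List (Fin s)
  block m = C (phase m)

  open Concatenation block (nonempty ∘ phase) public using (word; blockStart; n≤blockStart; concat-slope)

  short-blocks : ∀ η → 0ℚ < η → ∃ λ M → ∀ m → M ℕ.≤ m → fromℕ (length (block m)) ≤ fromℕ (blockStart m) * η
  short-blocks η 0<η with ∃1/suc≤ η 0<η
  ... | d , 1/suc-d≤η with eventually-phase≥ (suc d)
  ... | M , late = M , λ m M≤m → let ℓ = length (block m) in begin
    fromℕ ℓ                               ≡⟨ x*fromℕ-suc*1/suc (fromℕ ℓ) d ⟨
    fromℕ ℓ * fromℕ (suc d) * 1/suc d      ≡⟨ cong (_* 1/suc d) (fromℕ-* ℓ (suc d)) ⟨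
    fromℕ (ℓ ℕ.* suc d) * 1/suc d          ≤⟨ *-monoʳ-≤-0≤ (<⇒≤ (0<1/suc d)) (fromℕ-mono-≤ (ℓ*[1+d]≤blockStart m (late m M≤m))) ⟩
    fromℕ (blockStart m) * 1/suc d         ≤⟨ *-monoˡ-≤-0≤ (0≤fromℕ (blockStart m)) 1/suc-d≤η ⟩
    fromℕ (blockStart m) * η               ∎
    where
    open ≤-Reasoning
    ℓ*[1+d]≤blockStart : ∀ m → suc d ℕ.≤ phase m → length (block m) ℕ.* suc d ℕ.≤ blockStart m
    ℓ*[1+d]≤blockStart m d<phase = ℕ.≤-trans (ℕ.*-monoʳ-≤ (length (block m)) d<phase)
      (ℕ.≤-trans (ℕ.≤-reflexive (ℕ.*-comm (length (block m)) (phase m)))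
      (ℕ.≤-trans (phase-invariant m) (n≤blockStart m)))

  module _ (X : WA s) (r : ℚ) (cycles : ∀ j → CycleWithSlope X (r - 1/suc j) (C j)) where

    sloped-blocks : ∀ ε → 0ℚ < ε → ∃ λ M → ∀ m → M ℕ.≤ m → fromℕ (length (block m)) * (r - ε) ≤ wsum X (qI X) (block m)
    sloped-blocks ε 0<ε with ∃1/suc≤ ε 0<ε
    ... | d , 1/suc-d≤ε with eventually-phase≥ d
    ... | M , late = M , λ m M≤m → ≤-trans
      (*-monoˡ-≤-0≤ (0≤fromℕ (length (block m))) (+-monoʳ-≤ r (neg-antimono-≤ (≤-trans (1/suc-antimono-≤ (late m M≤m)) 1/suc-d≤ε))))
      (proj₂ (cycles (phase m)))

    scheduled-liminf : LimInfAvg≥ X word r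
    scheduled-liminf = Equivalence.to (slope⇔liminf X word r)
      (concat-slope X (proj₁ ∘ cycles ∘ phase) r sloped-blocks short-blocks)

-- Cycles of the product automaton

module ReturnPaths {s k} (As : Fin k → WA s) (B : WA s) (SC : StronglyConnected As B) where

  initial : PState As B
  initial = (λ i → qI (As i)) , qI B

  returnBound : ℕ
  returnBound = ⨆Π k (nQ ∘ As) λ g → ⨆ (nQ B) λ b → length (proj₁ (SC (g , b) initial))

  returnPath : ∀ p → ∃ λ y → length y ℕ.≤ returnBound × PStep As B p y initial
  returnPath (f , b) with ≤-⨆Π k (nQ ∘ As) (λ g → ⨆ (nQ B) λ b → length (proj₁ (SC (g , b) initial))) f
  ... | g , g≗f , ≤bound = y , ℕ.≤-trans (≤-⨆ (λ b → length (proj₁ (SC (g , b) initial))) b) ≤bound ,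
                           (λ i → subst (λ q → δ* (As i) q y ≡ qI (As i)) (g≗f i) (proj₁ (proj₂ (SC (g , b) initial)) i)) ,
                           proj₂ (proj₂ (SC (g , b) initial))
    where y = proj₁ (SC (g , b) initial)

cycle-from-prefix : ∀ {s} (X : WA s) u r ε η D t y → 0ℚ ≤ ε →
  fromℕ t * (r - η) ≤ psum X u t →
  length y ℕ.≤ D → fromℕ D * fromℕ (weightBound X ℕ.+ upperℕ r) ≤ fromℕ t * (ε - η) →
  δ* X (run X u t) y ≡ qI X →
  CycleWithSlope X (r - ε) (prefix u t ++ y)
cycle-from-prefix X u r ε η D t y 0≤ε prefix-slope |y|≤D short returns = returns′ , slope
  where
  W = fromℕ (weightBound X)
  R = fromℕ (upperℕ r)
  returns′ : δ* X (qI X) (prefix u t ++ y) ≡ qI X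
  returns′ = trans (δ*-++ X (qI X) (prefix u t) y) (trans (cong (λ q → δ* X q y) (δ*-prefix X u t)) returns)
  short-y : fromℕ (length y) * (W + R) ≤ fromℕ t * (ε - η)
  short-y = begin
    fromℕ (length y) * (W + R)                  ≡⟨ cong (fromℕ (length y) *_) (fromℕ-+ (weightBound X) (upperℕ r)) ⟨
    fromℕ (length y) * fromℕ (weightBound X ℕ.+ upperℕ r) ≤⟨ *-monoʳ-≤-0≤ (0≤fromℕ (weightBound X ℕ.+ upperℕ r)) (fromℕ-mono-≤ |y|≤D) ⟩
    fromℕ D * fromℕ (weightBound X ℕ.+ upperℕ r) ≤⟨ short ⟩
    fromℕ t * (ε - η)                           ∎
    where open ≤-Reasoning
  slope : fromℕ (length (prefix u t ++ y)) * (r - ε) ≤ wsum X (qI X) (prefix u t ++ y)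
  slope = begin
    fromℕ (length (prefix u t ++ y)) * (r - ε)   ≡⟨ cong (λ n → fromℕ n * (r - ε)) (trans (List.length-++ (prefix u t)) (cong (ℕ._+ length y) (length-prefix u t))) ⟩
    fromℕ (t ℕ.+ length y) * (r - ε)             ≡⟨ cong (_* (r - ε)) (fromℕ-+ t (length y)) ⟩
    (fromℕ t + fromℕ (length y)) * (r - ε)       ≤⟨ slope-append {L = fromℕ t} {S = psum X u t} {r = r} {ε} {η} (0≤fromℕ (length y)) (-≤upperℕ r 0≤ε)
                                                      (≤-trans prefix-slope (≤-reflexive (sym (+-identityʳ (psum X u t)))))
                                                      (-length*weightBound≤wsum X (run X u t) y) short-y ⟩
    (psum X u t + wsum X (run X u t) y) + 0ℚ     ≡⟨ +-identityʳ _ ⟩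
    psum X u t + wsum X (run X u t) y            ≡⟨ cong₂ (λ v q → v + wsum X q y) (wsum-prefix X u t) (δ*-prefix X u t) ⟨
    wsum X (qI X) (prefix u t) + wsum X (δ* X (qI X) (prefix u t)) y ≡⟨ wsum-++ X (qI X) (prefix u t) y ⟨
    wsum X (qI X) (prefix u t ++ y)              ∎
    where open ≤-Reasoning

module _ {s k} (As : Fin k → WA s) (B : WA s) (SC : StronglyConnected As B) (ra : Fin k → ℚ) (rb : ℚ) (u : Word s)
         (limsupB : LimSupAvg≥ B u rb) (liminfA : ∀ i → LimInfAvg≥ (As i) u (ra i)) where
  open ReturnPaths As B SC

  module _ (ε : ℚ) (0<ε : 0ℚ < ε) where
    private
      η = fraction ε 1
      0<η = 0<fraction 1 0<ε

      cheapDetourFrom : WA s → ℚ → ℕ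
      cheapDetourFrom X r = proj₁ (archimedean (fromℕ returnBound * fromℕ (weightBound X ℕ.+ upperℕ r)) η 0<η)

      cheap-detour : ∀ X r t → cheapDetourFrom X r ℕ.≤ t → fromℕ returnBound * fromℕ (weightBound X ℕ.+ upperℕ r) ≤ fromℕ t * (ε - η)
      cheap-detour X r t cheapDetourFrom≤t = subst (λ x → _ ≤ fromℕ t * x) (sym (half-complement ε))
        (proj₂ (archimedean (fromℕ returnBound * fromℕ (weightBound X ℕ.+ upperℕ r)) η 0<η) t cheapDetourFrom≤t)

      slopeA : ∀ i → ∃ λ N → ∀ t → N ℕ.≤ t → fromℕ t * (ra i - η) ≤ psum (As i) u t
      slopeA i = Equivalence.from (slope⇔liminf (As i) u (ra i)) (liminfA i) η 0<η

      goodFromA : Fin k → ℕ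
      goodFromA i = proj₁ (slopeA i) ⊔ cheapDetourFrom (As i) (ra i)

      N : ℕ
      N = cheapDetourFrom B rb ⊔ ⨆ k goodFromA

    good-cycle : ∃ λ xs → 0 ℕ.< length xs × CycleWithSlope B (rb - ε) xs × (∀ i → CycleWithSlope (As i) (ra i - ε) xs)
    good-cycle = at-time (limsup⇒often B u rb limsupB η 0<η (suc N))
      where
      at-time : (∃ λ t → suc N ℕ.≤ t × fromℕ t * (rb - η) ≤ psum B u t) →
                ∃ λ xs → 0 ℕ.< length xs × CycleWithSlope B (rb - ε) xs × (∀ i → CycleWithSlope (As i) (ra i - ε) xs)
      at-time (t , N<t , slopeB-t) = prefix u t ++ y ,
        ℕ.≤-trans (ℕ.≤-trans (ℕ.≤-trans (ℕ.s≤s ℕ.z≤n) N<t) (ℕ.≤-reflexive (sym (length-prefix u t)))) (List.length-++-≤ˡ (prefix u t)) ,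
        cycle-from-prefix B u rb ε η returnBound t y (<⇒≤ 0<ε) slopeB-t |y|≤ (cheap-detour B rb t (N≤ (ℕ.m≤m⊔n (cheapDetourFrom B rb) (⨆ k goodFromA)))) (proj₂ steps) ,
        λ i → cycle-from-prefix (As i) u (ra i) ε η returnBound t y (<⇒≤ 0<ε)
                (proj₂ (slopeA i) t (N≤ (ℕ.≤-trans (ℕ.m≤m⊔n (proj₁ (slopeA i)) (cheapDetourFrom (As i) (ra i))) (goodFromA≤N i))))
                |y|≤ (cheap-detour (As i) (ra i) t (N≤ (ℕ.≤-trans (ℕ.m≤n⊔m (proj₁ (slopeA i)) (cheapDetourFrom (As i) (ra i))) (goodFromA≤N i)))) (proj₁ steps i)
        where
        path = returnPath ((λ i → run (As i) u t) , run B u t)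
        y = proj₁ path
        |y|≤ = proj₁ (proj₂ path)
        steps = proj₂ (proj₂ path)
        N≤ : ∀ {n} → n ℕ.≤ N → n ℕ.≤ t
        N≤ n≤N = ℕ.≤-trans n≤N (ℕ.≤-trans (ℕ.n≤1+n N) N<t)
        goodFromA≤N : ∀ i → goodFromA i ℕ.≤ N
        goodFromA≤N i = ℕ.≤-trans (≤-⨆ goodFromA i) (ℕ.m≤n⊔m (cheapDetourFrom B rb) (⨆ k goodFromA))

lemma6 : ∀ {s k : ℕ} (As : Fin k → WA s) (B : WA s) →
    StronglyConnected As B →
    (ra : Fin k → ℚ) (rb : ℚ) →
    (∃ λ (u : Word s) → LimSupAvg≥ B u rb × (∀ i → LimInfAvg≥ (As i) u (ra i)))
    ⇔
    (∃ λ (u′ : Word s) → LimInfAvg≥ B u′ rb × (∀ i → LimInfAvg≥ (As i) u′ (ra i)))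
lemma6 {s} {k} As B SC ra rb = mk⇔ forward backward
  where
  forward : (∃ λ (u : Word s) → LimSupAvg≥ B u rb × (∀ i → LimInfAvg≥ (As i) u (ra i))) →
            ∃ λ (u′ : Word s) → LimInfAvg≥ B u′ rb × (∀ i → LimInfAvg≥ (As i) u′ (ra i))
  forward (u , limsupB , liminfA) =
    word , scheduled-liminf B rb (λ j → proj₁ (cycles j)) , λ i → scheduled-liminf (As i) (ra i) (λ j → proj₂ (cycles j) i)
    where
    cycle : ∀ j → ∃ λ xs → 0 ℕ.< length xs × CycleWithSlope B (rb - 1/suc j) xs × (∀ i → CycleWithSlope (As i) (ra i - 1/suc j) xs)
    cycle j = good-cycle As B SC ra rb u limsupB liminfA (1/suc j) (0<1/suc j)
    cycles : ∀ j → CycleWithSlope B (rb - 1/suc j) (proj₁ (cycle j)) × (∀ i → CycleWithSlope (As i) (ra i - 1/suc j) (proj₁ (cycle j)))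
    cycles j = proj₂ (proj₂ (cycle j))
    open Schedule (proj₁ ∘ cycle) (proj₁ ∘ proj₂ ∘ cycle)
  backward : (∃ λ (u′ : Word s) → LimInfAvg≥ B u′ rb × (∀ i → LimInfAvg≥ (As i) u′ (ra i))) →
             ∃ λ (u : Word s) → LimSupAvg≥ B u rb × (∀ i → LimInfAvg≥ (As i) u (ra i))
  backward (u , liminfB , liminfA) = u , liminf⇒limsup B u rb liminfB , liminfA
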